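{- Let $\mathcal C$ be a coherent configuration and $X,Y,Z$ pairwise distinct fibers of size $4$. If $\mathcal C[X,Y]$ and $\mathcal C[Z,Y]$ are both of type $2K_{2,2}$ and are directly connected at $Y$, then either $\mathcal C[X,Z]$ contains a matching basis relation, or $\mathcal C[X,Z]$ is of type $2K_{2,2}$ and moreover $\mathcal C[Z,X]$ and $\mathcal C[Y,X]$ are directly connected at $X$ and $\mathcal C[X,Z]$ and $\mathcal C[Y,Z]$ are directly connected at $Z$.
   Context: A coherent configuration on a finite set $V$ is a partition $\mathcal C$ of $V\times V$ into basis relations such that: (A) a basis relation containing a loop consists of loops; (B) the transpose of a basis relation is a basis relation; (C) for all $R,S,T\in\mathcal C$ the number $|\{w:uw\in R,wv\in S\}|$ is the same for all $uv\in T$. Fibers are sets $X$ with $\{xx:x\in X\}\in\mathcal C$; $\mathcal C[X,Y]$ is the set of basis relations contained in $X\times Y$. A basis relation $M\in\mathcal C[X,Z]$ ($X\neq Z$) is a matching if each point of $X$ is the first coordinate of exactly one pair of $M$ and each point of $Z$ the second coordinate of exactly one pair. For distinct 4-point fibers $A,B$, $\mathcal C[A,B]$ is of type $2K_{2,2}$ if it consists of exactly two basis relations $R$ and $(A\times B)\setminus R$ where, for suitable enumerations $A=\{a_1,\dots,a_4\}$, $B=\{b_1,\dots,b_4\}$, $R=\{a_1,a_2\}\times\{b_1,b_2\}\cup\{a_3,a_4\}\times\{b_3,b_4\}$; in this case $\mathcal C[A,B]$ determines in $B$ the relation $\{b_1b_2,b_2b_1,b_3b_4,b_4b_3\}$ (which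 is a basis relation of $\mathcal C$). Two interspaces $\mathcal C[A,B]$ and $\mathcal C[D,B]$ of type $2K_{2,2}$ are directly connected at $B$ if they determine the same relation in $B$. -}

module Defs where

open import Data.Nat using (ℕ; _≟_)
open import Data.Fin using (Fin; zero; suc)
open import Data.Fin.Subset using (Subset; _∈_; ∣_∣)
open import Data.List using (List; length; filter)
open import Data.List.Base using ()
open import Data.Fin.Base using ()
open import Data.List using () renaming (_∷_ to _∷ₗ_)
open import Data.Product using (Σ; ∃; _×_; _,_; ∃!)
open import Data.Sum using (_⊎_)
open import Relation.Binary.PropositionalEquality using (_≡_; _≢_)
open import Relation.Nullary using (¬_)
open import Relation.Nullary.Decidable using (_×-dec_)
open import Function.Bundles using (_⇔_)
open import Data.List using () renaming ([] to []ₗ)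
import Data.List as L
import Data.Fin as F

points : (n : ℕ) → List (Fin n)
points n = L.allFin n

-- A coherent configuration on V = Fin n, given by a colouring of V × V
-- with colours in ℕ.  The basis relations are the nonempty colour classes
-- { uv | col u v ≡ c }.
record CoherentConfiguration (n : ℕ) : Set where
  field
    col : Fin n → Fin n → ℕ
    loops : ∀ u v w → col u u ≡ col v w → v ≡ w
    transpose : ∀ u v u′ v′ → col u v ≡ col u′ v′ → col v u ≡ col v′ u′
  paths : ℕ → ℕ → Fin n → Fin n → ℕ
  paths i j u v =
    length (filter (λ w → (col u w ≟ i) ×-dec (col w v ≟ j)) (points n))
  field
    coherent : ∀ i j u v u′ v′ → col u v ≡ col u′ v′ →
               paths i j u v ≡ paths i j u′ v′

module _ {n : ℕ} (𝒞 : CoherentConfiguration n) where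
  open CoherentConfiguration 𝒞

  -- X is a fiber: { xx | x ∈ X } is a basis relation (i.e. a nonempty
  -- colour class consisting exactly of the loops at points of X).
  IsFiber : Subset n → Set
  IsFiber X = Σ (Fin n) λ x → x ∈ X × (∀ y → (y ∈ X) ⇔ (col y y ≡ col x x))

  InInterspace : Subset n → Subset n → ℕ → Set
  InInterspace X Z c = (∃ λ u → ∃ λ v → col u v ≡ c) ×
                       (∀ u v → col u v ≡ c → u ∈ X × v ∈ Z)

  IsMatching : Subset n → Subset n → ℕ → Set
  IsMatching X Z c =
    (∀ x → x ∈ X → ∃! _≡_ λ z → z ∈ Z × col x z ≡ c) ×
    (∀ z → z ∈ Z → ∃! _≡_ λ x → x ∈ X × col x z ≡ c)

  HasMatching : Subset n → Subset n → Set
  HasMatching X Z = Σ ℕ λ c → InInterspace X Z c × IsMatching X Z c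

  Enumerates : (Fin 4 → Fin n) → Subset n → Set
  Enumerates a X = (∀ i j → a i ≡ a j → i ≡ j) × (∀ i → a i ∈ X) ×
                   (∀ x → x ∈ X → ∃ λ i → a i ≡ x)

block : Fin 4 → Fin 2
block zero = zero
block (suc zero) = zero
block (suc (suc zero)) = suc zero
block (suc (suc (suc zero))) = suc zero

module _ {n : ℕ} (𝒞 : CoherentConfiguration n) where
  open CoherentConfiguration 𝒞

  -- Witness that 𝒞[A,B] is of type 2K_{2,2}: enumerations a of A, b of B,
  -- and two distinct colours r, s such that 𝒞[A,B] = {R, (A×B)∖R} where
  -- R = {a1,a2}×{b1,b2} ∪ {a3,a4}×{b3,b4} is the colour class r and
  -- its complement in A×B is the colour class s.
  record Type2K22 (A B : Subset n) : Set where
    field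
      a : Fin 4 → Fin n
      b : Fin 4 → Fin n
      a-enum : Enumerates 𝒞 a A
      b-enum : Enumerates 𝒞 b B
      r : ℕ
      s : ℕ
      r-in : InInterspace 𝒞 A B r
      s-in : InInterspace 𝒞 A B s
      r≢s : r ≢ s
      sameBlock : ∀ i j → block i ≡ block j → col (a i) (b j) ≡ r
      diffBlock : ∀ i j → block i ≢ block j → col (a i) (b j) ≡ s

    determined : Fin n → Fin n → Set
    determined u v = ∃ λ i → ∃ λ j →
      i ≢ j × block i ≡ block j × u ≡ b i × v ≡ b j

  DirectlyConnected : (A D B : Subset n) → Set
  DirectlyConnected A D B =
    Σ (Type2K22 A B) λ w₁ → Σ (Type2K22 D B) λ w₂ →
      ∀ u v → Type2K22.determined w₁ u v ⇔ Type2K22.determined w₂ u v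

-- Since 𝒞[X,Y] and 𝒞[Z,Y] determine the same pairing of Y, the enumeration of Z
-- can be reindexed so that both interspaces use one enumeration b of Y. For
-- x = a i and z = c j the path a i → b i → c j then shows, by coherence, that a
-- colour of 𝒞[X,Z] met on a same-block pair (i, j) is met only on same-block
-- pairs, and likewise for different-block pairs. Valencies are constant on
-- fibers, so such a colour has out- and in-degree 1 or 2 throughout: degree 1
-- gives a matching, and otherwise each colour fills all same-block, resp. all
-- different-block, pairs, which makes 𝒞[X,Z] of type 2K₂,₂ with the pairings of
-- X and Z that the given interspaces determine.

module Submission where

open import Defs
open import Data.Nat using (ℕ; _≤_; _<_; z≤n; s≤s) renaming (_≟_ to _≟ℕ_)
open import Data.Fin using (Fin; zero; suc) renaming (_≟_ to _≟F_)
open import Data.Fin.Patterns using (0F; 1F; 2F; 3F)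
open import Data.Fin.Subset using (Subset; ∣_∣; _∈_)
open import Data.Product using (_×_; _,_; proj₁; proj₂; ∃; ∃₂; Σ; ∃!)
open import Data.Sum using (_⊎_; inj₁; inj₂)
open import Data.Empty using (⊥-elim)
open import Data.List using (List; []; _∷_; length; filter)
open import Data.List.Properties using (filter-≐)
open import Data.List.Membership.Propositional using () renaming (_∈_ to _∈ₗ_)
open import Data.List.Membership.Propositional.Properties
  using (∈-filter⁺; ∈-filter⁻; ∈-allFin; ∈-length)
open import Data.List.Relation.Unary.Any using (here; there)
open import Data.List.Relation.Unary.All using (_∷_)
open import Data.List.Relation.Unary.AllPairs using (_∷_)
open import Data.List.Relation.Unary.Unique.Propositional using (Unique)
open import Data.List.Relation.Unary.Unique.Propositional.Properties using (allFin⁺; filter⁺)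
open import Relation.Binary.PropositionalEquality
  using (_≡_; _≢_; refl; sym; trans; cong; subst; subst₂; module ≡-Reasoning)
open import Relation.Nullary using (yes; no)
open import Relation.Nullary.Decidable using (_×-dec_)
open import Function using (_∘_; case_of_)
open import Function.Bundles using (_⇔_; mk⇔; Equivalence)
open import Function.Properties.Equivalence using () renaming (refl to ⇔-refl)

module _ {A : Set} where

  nonempty⇒∈ : {xs : List A} → 0 < length xs → ∃ λ x → x ∈ₗ xs
  nonempty⇒∈ {x ∷ _} _ = x , here refl

  ∈-≢⇒2≤length : {x y : A} {xs : List A} → x ≢ y → x ∈ₗ xs → y ∈ₗ xs → 2 ≤ length xs
  ∈-≢⇒2≤length x≢y (here refl) (here refl) = ⊥-elim (x≢y refl)
  ∈-≢⇒2≤length _   (here _)    (there y∈) = s≤s (∈-length y∈)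
  ∈-≢⇒2≤length _   (there x∈)  _          = s≤s (∈-length x∈)

  2≤length⇒∈-≢ : {xs : List A} → Unique xs → 2 ≤ length xs →
                 ∃₂ λ x y → x ≢ y × x ∈ₗ xs × y ∈ₗ xs
  2≤length⇒∈-≢ {x ∷ y ∷ _} ((x≢y ∷ _) ∷ _) _ = x , y , x≢y , here refl , there (here refl)
  2≤length⇒∈-≢ {_ ∷ []} _ (s≤s ())

  unique-∈⇒length≡1 : {x : A} {xs : List A} → Unique xs → x ∈ₗ xs →
                      (∀ {y} → y ∈ₗ xs → y ≡ x) → length xs ≡ 1
  unique-∈⇒length≡1 {xs = _ ∷ []} _ _ _ = refl
  unique-∈⇒length≡1 {xs = _ ∷ _ ∷ _} ((y≢z ∷ _) ∷ _) _ all≡x =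
    ⊥-elim (y≢z (trans (all≡x (here refl)) (sym (all≡x (there (here refl))))))

  length≡1⇒singleton : {xs : List A} → length xs ≡ 1 → ∃ λ x → xs ≡ x ∷ []
  length≡1⇒singleton {x ∷ []} _ = x , refl

xor : Fin 2 → Fin 2 → Fin 2
xor 0F y  = y
xor 1F 0F = 1F
xor 1F 1F = 0F

≢⇒≡xor1 : {x y : Fin 2} → x ≢ y → x ≡ xor 1F y
≢⇒≡xor1 {0F} {0F} x≢y = ⊥-elim (x≢y refl)
≢⇒≡xor1 {0F} {1F} _   = refl
≢⇒≡xor1 {1F} {0F} _   = refl
≢⇒≡xor1 {1F} {1F} x≢y = ⊥-elim (x≢y refl)

xor-cancelʳ : ∀ {x y} β → xor x β ≡ xor y β → x ≡ y
xor-cancelʳ {0F} {0F} _  _  = refl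
xor-cancelʳ {0F} {1F} 0F ()
xor-cancelʳ {0F} {1F} 1F ()
xor-cancelʳ {1F} {0F} 0F ()
xor-cancelʳ {1F} {0F} 1F ()
xor-cancelʳ {1F} {1F} _  _  = refl

blockShift : Fin 2 → Fin 4 → Fin 4
blockShift 0F j  = j
blockShift 1F 0F = 2F
blockShift 1F 1F = 3F
blockShift 1F 2F = 0F
blockShift 1F 3F = 1F

block-blockShift : ∀ β j → block (blockShift β j) ≡ xor (block j) β
block-blockShift 0F 0F = refl
block-blockShift 0F 1F = refl
block-blockShift 0F 2F = refl
block-blockShift 0F 3F = refl
block-blockShift 1F 0F = refl
block-blockShift 1F 1F = refl
block-blockShift 1F 2F = refl
block-blockShift 1F 3F = refl

blockShift-involutive : ∀ β j → blockShift β (blockShift β j) ≡ j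
blockShift-involutive 0F j  = refl
blockShift-involutive 1F 0F = refl
blockShift-involutive 1F 1F = refl
blockShift-involutive 1F 2F = refl
blockShift-involutive 1F 3F = refl

blockShift-injective : ∀ β {i j} → blockShift β i ≡ blockShift β j → i ≡ j
blockShift-injective β {i} {j} e =
  trans (sym (blockShift-involutive β i))
        (trans (cong (blockShift β) e) (blockShift-involutive β j))

≢⇒sameBlock-blockShift : ∀ {i} j → block i ≢ block j → block i ≡ block (blockShift 1F j)
≢⇒sameBlock-blockShift 0F = ≢⇒≡xor1
≢⇒sameBlock-blockShift 1F = ≢⇒≡xor1
≢⇒sameBlock-blockShift 2F = ≢⇒≡xor1
≢⇒sameBlock-blockShift 3F = ≢⇒≡xor1

RespectsBlocks : (Fin 4 → Fin 2) → Set
RespectsBlocks g = ∀ k k′ → k ≢ k′ → (block k ≡ block k′ ⇔ g k ≡ g k′)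

respectsBlocks⇒xor : ∀ {g} → RespectsBlocks g → ∀ k → g k ≡ xor (block k) (g 0F)
respectsBlocks⇒xor g-resp 0F = refl
respectsBlocks⇒xor g-resp 1F = Equivalence.to (g-resp 1F 0F (λ ())) refl
respectsBlocks⇒xor g-resp 2F =
  ≢⇒≡xor1 (λ e → case Equivalence.from (g-resp 2F 0F (λ ())) e of λ ())
respectsBlocks⇒xor g-resp 3F =
  ≢⇒≡xor1 (λ e → case Equivalence.from (g-resp 3F 0F (λ ())) e of λ ())

partner : Fin 4 → Fin 4
partner 0F = 1F
partner 1F = 0F
partner 2F = 3F
partner 3F = 2F

sameBlock⇒≡∨≡partner : ∀ i j → block i ≡ block j → j ≡ i ⊎ j ≡ partner i
sameBlock⇒≡∨≡partner 0F 0F _ = inj₁ refl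
sameBlock⇒≡∨≡partner 0F 1F _ = inj₂ refl
sameBlock⇒≡∨≡partner 1F 0F _ = inj₂ refl
sameBlock⇒≡∨≡partner 1F 1F _ = inj₁ refl
sameBlock⇒≡∨≡partner 2F 2F _ = inj₁ refl
sameBlock⇒≡∨≡partner 2F 3F _ = inj₂ refl
sameBlock⇒≡∨≡partner 3F 2F _ = inj₂ refl
sameBlock⇒≡∨≡partner 3F 3F _ = inj₁ refl
sameBlock⇒≡∨≡partner 0F 2F ()
sameBlock⇒≡∨≡partner 0F 3F ()
sameBlock⇒≡∨≡partner 1F 2F ()
sameBlock⇒≡∨≡partner 1F 3F ()
sameBlock⇒≡∨≡partner 2F 0F ()
sameBlock⇒≡∨≡partner 2F 1F ()
sameBlock⇒≡∨≡partner 3F 0F ()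
sameBlock⇒≡∨≡partner 3F 1F ()

sameBlock-pair : ∀ {i j₁ j₂ j} → j₁ ≢ j₂ → block i ≡ block j₁ → block i ≡ block j₂ →
                 block i ≡ block j → j ≡ j₁ ⊎ j ≡ j₂
sameBlock-pair {i} {j₁} {j₂} {j} j₁≢j₂ i~j₁ i~j₂ i~j
  with sameBlock⇒≡∨≡partner i j₁ i~j₁ | sameBlock⇒≡∨≡partner i j₂ i~j₂
     | sameBlock⇒≡∨≡partner i j i~j
... | inj₁ refl | _         | inj₁ refl = inj₁ refl
... | inj₂ refl | _         | inj₂ refl = inj₁ refl
... | _         | inj₁ refl | inj₁ refl = inj₂ refl
... | _         | inj₂ refl | inj₂ refl = inj₂ refl
... | inj₁ refl | inj₁ refl | inj₂ _    = ⊥-elim (j₁≢j₂ refl)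
... | inj₂ refl | inj₂ refl | inj₁ _    = ⊥-elim (j₁≢j₂ refl)

module Configuration {n : ℕ} (𝒞 : CoherentConfiguration n) where
  open CoherentConfiguration 𝒞

  col-transpose : ∀ {u v u′ v′} → col u v ≡ col u′ v′ → col v u ≡ col v′ u′
  col-transpose = transpose _ _ _ _

  module _ {a : Fin 4 → Fin n} {A : Subset n} (a-enum : Enumerates 𝒞 a A) where

    enum-injective : ∀ {i j} → a i ≡ a j → i ≡ j
    enum-injective = proj₁ a-enum _ _

    enum-∈ : ∀ i → a i ∈ A
    enum-∈ = proj₁ (proj₂ a-enum)

    enum-onto : ∀ {x} → x ∈ A → ∃ λ i → a i ≡ x
    enum-onto = proj₂ (proj₂ a-enum) _

  InInterspace⇒∈ : ∀ {X Z c u v} → InInterspace 𝒞 X Z c → col u v ≡ c → u ∈ X × v ∈ Z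
  InInterspace⇒∈ (_ , in-X×Z) = in-X×Z _ _

  pathMiddles : ℕ → ℕ → Fin n → Fin n → List (Fin n)
  pathMiddles i j u v = filter (λ w → (col u w ≟ℕ i) ×-dec (col w v ≟ℕ j)) (points n)

  path-transfer : ∀ {i j u v u′ v′ w} → col u v ≡ col u′ v′ → col u w ≡ i → col w v ≡ j →
                  ∃ λ w′ → col u′ w′ ≡ i × col w′ v′ ≡ j
  path-transfer {i} {j} {u} {v} {u′} {v′} {w} uv≡u′v′ uw wv =
    let w∈ = ∈-filter⁺ (λ w → (col u w ≟ℕ i) ×-dec (col w v ≟ℕ j)) (∈-allFin w) (uw , wv)
        (w′ , w′∈) = nonempty⇒∈ (subst (0 <_) (coherent i j u v u′ v′ uv≡u′v′) (∈-length w∈))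
    in w′ , proj₂ (∈-filter⁻ (λ w → (col u′ w ≟ℕ i) ×-dec (col w v′ ≟ℕ j))
                             {xs = points n} w′∈)

  outNeighbours : ℕ → Fin n → List (Fin n)
  outNeighbours c u = filter (λ w → col u w ≟ℕ c) (points n)

  outDegree : ℕ → Fin n → ℕ
  outDegree c u = length (outNeighbours c u)

  ∈-outNeighbours⁺ : ∀ {c u w} → col u w ≡ c → w ∈ₗ outNeighbours c u
  ∈-outNeighbours⁺ {c} {u} {w} = ∈-filter⁺ (λ w → col u w ≟ℕ c) (∈-allFin w)

  ∈-outNeighbours⁻ : ∀ {c u w} → w ∈ₗ outNeighbours c u → col u w ≡ c
  ∈-outNeighbours⁻ {c} {u} = proj₂ ∘ ∈-filter⁻ (λ w → col u w ≟ℕ c) {xs = points n}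

  outNeighbours-unique : ∀ {c u} → Unique (outNeighbours c u)
  outNeighbours-unique {c} {u} = filter⁺ (λ w → col u w ≟ℕ c) (allFin⁺ n)

  outNeighbours≡pathMiddles : ∀ {c t u} → (∀ {w} → col u w ≡ c → col w u ≡ t) →
                              outNeighbours c u ≡ pathMiddles c t u u
  outNeighbours≡pathMiddles {c} {t} {u} back =
    filter-≐ (λ w → col u w ≟ℕ c) (λ w → (col u w ≟ℕ c) ×-dec (col w u ≟ℕ t))
             ((λ uw → uw , back uw) , proj₁) (points n)

  -- Every c-neighbour w of u satisfies col w u ≡ col w₀ u, so the c-neighbours
  -- are the middles of (c, col w₀ u)-paths from u to u, which coherence counts.
  outDegree-cong : ∀ {c u u′ w₀} → col u u ≡ col u′ u′ → col u w₀ ≡ c →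
                   outDegree c u ≡ outDegree c u′
  outDegree-cong {c} {u} {u′} {w₀} uu≡u′u′ uw₀ = begin
    outDegree c u                    ≡⟨ cong length (outNeighbours≡pathMiddles
                                          (λ uw → col-transpose (trans uw (sym uw₀)))) ⟩
    paths c (col w₀ u) u u           ≡⟨ coherent c (col w₀ u) u u u′ u′ uu≡u′u′ ⟩
    paths c (col w₀ u) u′ u′         ≡⟨ cong length (sym (outNeighbours≡pathMiddles
                                          (λ u′w → col-transpose (trans u′w (sym uw₀))))) ⟩
    outDegree c u′                   ∎
    where open ≡-Reasoning

  fiber-loops : ∀ {X x y} → IsFiber 𝒞 X → x ∈ X → y ∈ X → col x x ≡ col y y
  fiber-loops (_ , _ , ∈X⇔) x∈X y∈X =
    trans (Equivalence.to (∈X⇔ _) x∈X) (sym (Equivalence.to (∈X⇔ _) y∈X))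

  loop-colour⇒∈ : ∀ {X x u} → IsFiber 𝒞 X → x ∈ X → col u u ≡ col x x → u ∈ X
  loop-colour⇒∈ (_ , _ , ∈X⇔) x∈X uu≡xx =
    Equivalence.from (∈X⇔ _) (trans uu≡xx (Equivalence.to (∈X⇔ _) x∈X))

  -- Transfer the paths x → x → z and x → z → z to u v; loops force the
  -- middle point to be u, resp. v, which thereby get the loop colours of x, z.
  fiber-interspace : ∀ {X Z x z} → IsFiber 𝒞 X → IsFiber 𝒞 Z → x ∈ X → z ∈ Z →
                     InInterspace 𝒞 X Z (col x z)
  fiber-interspace {x = x} {z} FX FZ x∈X z∈Z = (x , z , refl) , λ u v uv≡xz →
    let (w , uw , _) = path-transfer {w = x} (sym uv≡xz) refl refl
        (w′ , _ , w′v) = path-transfer {w = z} (sym uv≡xz) refl refl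
        uu≡xx = subst (λ y → col u y ≡ col x x) (sym (loops x u w (sym uw))) uw
        vv≡zz = subst (λ y → col y v ≡ col z z) (loops z w′ v (sym w′v)) w′v
    in loop-colour⇒∈ FX x∈X uu≡xx , loop-colour⇒∈ FZ z∈Z vv≡zz

  unique-out-neighbour : ∀ {X Z x₀ z₀} → IsFiber 𝒞 X → IsFiber 𝒞 Z → x₀ ∈ X → z₀ ∈ Z →
                         (∀ {w} → col x₀ w ≡ col x₀ z₀ → w ≡ z₀) →
                         ∀ {x} → x ∈ X → ∃! _≡_ λ z → z ∈ Z × col x z ≡ col x₀ z₀
  unique-out-neighbour {x₀ = x₀} {z₀} FX FZ x₀∈X z₀∈Z only-z₀ {x} x∈X
    with length≡1⇒singleton degree≡1
    where
    degree≡1 : outDegree (col x₀ z₀) x ≡ 1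
    degree≡1 = trans (sym (outDegree-cong (fiber-loops FX x₀∈X x∈X) refl))
                     (unique-∈⇒length≡1 outNeighbours-unique (∈-outNeighbours⁺ refl)
                                        (only-z₀ ∘ ∈-outNeighbours⁻))
  ... | z , neighbours≡[z] =
    z , (proj₂ (InInterspace⇒∈ (fiber-interspace FX FZ x₀∈X z₀∈Z) xz) , xz) ,
    λ (_ , xy) → sole (subst (_ ∈ₗ_) neighbours≡[z] (∈-outNeighbours⁺ xy))
    where
    xz : col x z ≡ col x₀ z₀
    xz = ∈-outNeighbours⁻ (subst (z ∈ₗ_) (sym neighbours≡[z]) (here refl))
    sole : ∀ {y} → y ∈ₗ z ∷ [] → z ≡ y
    sole (here y≡z) = sym y≡z

  matching : ∀ {X Z x₀ z₀} → IsFiber 𝒞 X → IsFiber 𝒞 Z → x₀ ∈ X → z₀ ∈ Z →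
             (∀ {w} → col x₀ w ≡ col x₀ z₀ → w ≡ z₀) →
             (∀ {w} → col w z₀ ≡ col x₀ z₀ → w ≡ x₀) → HasMatching 𝒞 X Z
  matching FX FZ x₀∈X z₀∈Z only-z₀ only-x₀ =
    _ , fiber-interspace FX FZ x₀∈X z₀∈Z ,
    (λ _ x∈X → unique-out-neighbour FX FZ x₀∈X z₀∈Z only-z₀ x∈X) ,
    λ _ z∈Z →
      let (x , (x∈X , zx) , sole) =
            unique-out-neighbour FZ FX z₀∈Z x₀∈X (only-x₀ ∘ col-transpose) z∈Z
      in x , (x∈X , col-transpose zx) , λ (y∈X , yz) → sole (y∈X , col-transpose yz)

  Enumerates-blockShift : ∀ β {a A} → Enumerates 𝒞 a A → Enumerates 𝒞 (a ∘ blockShift β) A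
  Enumerates-blockShift β {a} a-enum =
    (λ _ _ e → blockShift-injective β (enum-injective a-enum e)) , enum-∈ a-enum ∘ blockShift β ,
    λ _ x∈A → let (i , aᵢ≡x) = enum-onto a-enum x∈A in
              blockShift β i , trans (cong a (blockShift-involutive β i)) aᵢ≡x

  InInterspace-transpose : ∀ {A B p q c} → col p q ≡ c → InInterspace 𝒞 A B c →
                           InInterspace 𝒞 B A (col q p)
  InInterspace-transpose pq≡c (_ , in-A×B) = (_ , _ , refl) , λ u v vu≡qp →
    let (v∈A , u∈B) = in-A×B v u (trans (col-transpose vu≡qp) pq≡c) in u∈B , v∈A

  module _ {A B : Subset n} (w : Type2K22 𝒞 A B) where
    open Type2K22 w

    r⇒sameBlock : ∀ {i j} → col (a i) (b j) ≡ r → block i ≡ block j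
    r⇒sameBlock {i} {j} e with block i ≟F block j
    ... | yes i~j = i~j
    ... | no i≁j  = ⊥-elim (r≢s (trans (sym e) (diffBlock i j i≁j)))

    determined⇒sameBlock : ∀ {u v k k′} → determined u v → u ≡ b k → v ≡ b k′ →
                           block k ≡ block k′
    determined⇒sameBlock (i , j , _ , i~j , u≡bᵢ , v≡bⱼ) u≡bₖ v≡bₖ′ =
      subst₂ (λ k k′ → block k ≡ block k′)
             (enum-injective b-enum (trans (sym u≡bᵢ) u≡bₖ))
             (enum-injective b-enum (trans (sym v≡bⱼ) v≡bₖ′)) i~j

  _ᵀ : ∀ {A B} → Type2K22 𝒞 A B → Type2K22 𝒞 B A
  w ᵀ = record
    { a = b ; b = a ; a-enum = b-enum ; b-enum = a-enum
    ; r = col (b 0F) (a 0F) ; s = col (b 0F) (a 2F)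
    ; r-in = InInterspace-transpose (sameBlock 0F 0F refl) r-in
    ; s-in = InInterspace-transpose (diffBlock 2F 0F (λ ())) s-in
    ; r≢s = λ e → r≢s (trans (sym (sameBlock 0F 0F refl))
                       (trans (col-transpose e) (diffBlock 2F 0F (λ ()))))
    ; sameBlock = λ i j i~j →
        col-transpose (trans (sameBlock j i (sym i~j)) (sym (sameBlock 0F 0F refl)))
    ; diffBlock = λ i j i≁j →
        col-transpose (trans (diffBlock j i (i≁j ∘ sym)) (sym (diffBlock 2F 0F (λ ()))))
    }
    where open Type2K22 w

  -- Both witnesses pair B alike, so the permutation φ relating their enumerations
  -- of B maps blocks to blocks, possibly swapping them; blockShift undoes that on D.
  realign : ∀ {A D B} (w₁ : Type2K22 𝒞 A B) (w₂ : Type2K22 𝒞 D B) →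
            (∀ u v → Type2K22.determined w₁ u v ⇔ Type2K22.determined w₂ u v) →
            Σ (Type2K22 𝒞 D B) λ w → ∀ k → Type2K22.b w k ≡ Type2K22.b w₁ k
  realign {D = D} {B} w₁ w₂ connected = w , λ _ → refl
    where
    module W₁ = Type2K22 w₁
    module W₂ = Type2K22 w₂

    φ-spec : ∀ k → ∃ λ k′ → W₂.b k′ ≡ W₁.b k
    φ-spec k = enum-onto W₂.b-enum (enum-∈ W₁.b-enum k)

    φ : Fin 4 → Fin 4
    φ = proj₁ ∘ φ-spec

    b₂∘φ≡b₁ : ∀ k → W₂.b (φ k) ≡ W₁.b k
    b₂∘φ≡b₁ = proj₂ ∘ φ-spec

    φ-respectsBlocks : RespectsBlocks (block ∘ φ)
    φ-respectsBlocks k k′ k≢k′ = mk⇔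
      (λ k~k′ → determined⇒sameBlock w₂
        (Equivalence.to (connected _ _) (k , k′ , k≢k′ , k~k′ , refl , refl))
        (sym (b₂∘φ≡b₁ k)) (sym (b₂∘φ≡b₁ k′)))
      (λ φk~φk′ → determined⇒sameBlock w₁
        (Equivalence.from (connected _ _)
          (φ k , φ k′ , φk≢φk′ , φk~φk′ , sym (b₂∘φ≡b₁ k) , sym (b₂∘φ≡b₁ k′)))
        refl refl)
      where
      φk≢φk′ : φ k ≢ φ k′
      φk≢φk′ e = k≢k′ (enum-injective W₁.b-enum
                        (trans (sym (b₂∘φ≡b₁ k)) (trans (cong W₂.b e) (b₂∘φ≡b₁ k′))))

    β : Fin 2
    β = block (φ 0F)

    shifted-block⇔ : ∀ j k → block (blockShift β j) ≡ block (φ k) ⇔ block j ≡ block k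
    shifted-block⇔ j k = mk⇔
      (λ e → xor-cancelʳ β (trans (sym (block-blockShift β j))
                                  (trans e (respectsBlocks⇒xor φ-respectsBlocks k))))
      (λ j~k → trans (block-blockShift β j)
                     (trans (cong (λ x → xor x β) j~k)
                            (sym (respectsBlocks⇒xor φ-respectsBlocks k))))

    w : Type2K22 𝒞 D B
    w = record
      { a = W₂.a ∘ blockShift β ; b = W₁.b
      ; a-enum = Enumerates-blockShift β W₂.a-enum ; b-enum = W₁.b-enum
      ; r = W₂.r ; s = W₂.s ; r-in = W₂.r-in ; s-in = W₂.s-in ; r≢s = W₂.r≢s
      ; sameBlock = λ j k j~k →
          subst (λ y → col (W₂.a (blockShift β j)) y ≡ W₂.r) (b₂∘φ≡b₁ k)
                (W₂.sameBlock _ _ (Equivalence.from (shifted-block⇔ j k) j~k))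
      ; diffBlock = λ j k j≁k →
          subst (λ y → col (W₂.a (blockShift β j)) y ≡ W₂.s) (b₂∘φ≡b₁ k)
                (W₂.diffBlock _ _ (j≁k ∘ Equivalence.to (shifted-block⇔ j k)))
      }

  module _ {X Z : Subset n} (FX : IsFiber 𝒞 X) (FZ : IsFiber 𝒞 Z)
           {x z : Fin 4 → Fin n} (x-enum : Enumerates 𝒞 x X) (z-enum : Enumerates 𝒞 z Z) where

    private
      c₀ : ℕ
      c₀ = col (x 0F) (z 0F)

      c₀-interspace : InInterspace 𝒞 X Z c₀
      c₀-interspace = fiber-interspace FX FZ (enum-∈ x-enum 0F) (enum-∈ z-enum 0F)

    row-index : ∀ {i w} → col (x i) w ≡ c₀ → ∃ λ j → z j ≡ w
    row-index e = enum-onto z-enum (proj₂ (InInterspace⇒∈ c₀-interspace e))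

    column-index : ∀ {j w} → col w (z j) ≡ c₀ → ∃ λ i → x i ≡ w
    column-index e = enum-onto x-enum (proj₁ (InInterspace⇒∈ c₀-interspace e))

    -- Row 0 has two c₀-entries, so by outDegree-cong every row does; both lie
    -- in the block of the row, which they therefore fill.
    rows-constant : (∀ i j → col (x i) (z j) ≡ c₀ → block i ≡ block j) →
                    col (x 0F) (z 1F) ≡ c₀ →
                    ∀ i j → block i ≡ block j → col (x i) (z j) ≡ c₀
    rows-constant sameBlock-only x₀z₁ i j i~j
      with 2≤length⇒∈-≢ outNeighbours-unique two-in-row-i
      where
      two-in-row-i : 2 ≤ outDegree c₀ (x i)
      two-in-row-i =
        subst (2 ≤_) (outDegree-cong (fiber-loops FX (enum-∈ x-enum 0F) (enum-∈ x-enum i)) refl)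
              (∈-≢⇒2≤length (λ e → case enum-injective z-enum e of λ ())
                            (∈-outNeighbours⁺ refl) (∈-outNeighbours⁺ x₀z₁))
    ... | w₁ , w₂ , w₁≢w₂ , w₁∈ , w₂∈
      with row-index (∈-outNeighbours⁻ w₁∈) | row-index (∈-outNeighbours⁻ w₂∈)
    ... | j₁ , refl | j₂ , refl
      with sameBlock-pair (λ j₁≡j₂ → w₁≢w₂ (cong z j₁≡j₂))
             (sameBlock-only i j₁ (∈-outNeighbours⁻ w₁∈))
             (sameBlock-only i j₂ (∈-outNeighbours⁻ w₂∈)) i~j
    ... | inj₁ refl = ∈-outNeighbours⁻ w₁∈
    ... | inj₂ refl = ∈-outNeighbours⁻ w₂∈

  module _ {X Z : Subset n} (FX : IsFiber 𝒞 X) (FZ : IsFiber 𝒞 Z)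
           {x z : Fin 4 → Fin n} (x-enum : Enumerates 𝒞 x X) (z-enum : Enumerates 𝒞 z Z) where

    sameBlockConstant-or-matching :
      (∀ i j → col (x i) (z j) ≡ col (x 0F) (z 0F) → block i ≡ block j) →
      (∀ i j → block i ≡ block j → col (x i) (z j) ≡ col (x 0F) (z 0F)) ⊎ HasMatching 𝒞 X Z
    sameBlockConstant-or-matching sameBlock-only
      with col (x 0F) (z 1F) ≟ℕ col (x 0F) (z 0F) | col (x 1F) (z 0F) ≟ℕ col (x 0F) (z 0F)
    ... | yes x₀z₁ | _ = inj₁ (rows-constant FX FZ x-enum z-enum sameBlock-only x₀z₁)
    ... | no _ | yes x₁z₀ = inj₁ λ i j i~j → col-transpose
          (rows-constant FZ FX z-enum x-enum (λ j i e → sym (sameBlock-only i j (col-transpose e)))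
                         (col-transpose x₁z₀) j i (sym i~j))
    ... | no x₀z₁≢ | no x₁z₀≢ =
          inj₂ (matching FX FZ (enum-∈ x-enum 0F) (enum-∈ z-enum 0F) only-z₀ only-x₀)
      where
      only-z₀ : ∀ {w} → col (x 0F) w ≡ col (x 0F) (z 0F) → w ≡ z 0F
      only-z₀ e with row-index FX FZ x-enum z-enum e
      ... | j , refl with sameBlock⇒≡∨≡partner 0F j (sameBlock-only 0F j e)
      ...   | inj₁ refl = refl
      ...   | inj₂ refl = ⊥-elim (x₀z₁≢ e)

      only-x₀ : ∀ {w} → col w (z 0F) ≡ col (x 0F) (z 0F) → w ≡ x 0F
      only-x₀ e with column-index FX FZ x-enum z-enum e
      ... | i , refl with sameBlock⇒≡∨≡partner 0F i (sym (sameBlock-only i 0F e))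
      ...   | inj₁ refl = refl
      ...   | inj₂ refl = ⊥-elim (x₁z₀≢ e)

  module Aligned {X Y Z : Subset n} (FX : IsFiber 𝒞 X) (FZ : IsFiber 𝒞 Z)
                 (w₁ : Type2K22 𝒞 X Y) (w₂ : Type2K22 𝒞 Z Y)
                 (aligned : ∀ k → Type2K22.b w₂ k ≡ Type2K22.b w₁ k) where
    open Type2K22 w₁ using (a; a-enum; b-enum; r-in)
    open Type2K22 w₂ using () renaming (a to c; a-enum to c-enum)

    -- Coherence moves the path a i → b i → c j (colours r₁, r₂ᵀ) to one
    -- a i′ → b k → c j′, and both colours force k into the blocks of i′ and j′.
    sameBlock-colour-stays : ∀ {i j i′ j′} → col (a i) (c j) ≡ col (a i′) (c j′) →
                             block i ≡ block j → block i′ ≡ block j′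
    sameBlock-colour-stays {i} {j} {i′} {j′} e i~j
      with path-transfer e (Type2K22.sameBlock w₁ i i refl)
             (subst (λ y → col y (c j) ≡ Type2K22.r (w₂ ᵀ)) (aligned i)
                    (Type2K22.sameBlock (w₂ ᵀ) i j i~j))
    ... | w , a′w , wc′
      with enum-onto b-enum (proj₂ (InInterspace⇒∈ r-in a′w))
    ... | k , refl =
      trans (r⇒sameBlock w₁ a′w)
            (r⇒sameBlock (w₂ ᵀ) (subst (λ y → col y (c j′) ≡ _) (sym (aligned k)) wc′))

    BlockConstant : Set
    BlockConstant = (∀ i j → block i ≡ block j → col (a i) (c j) ≡ col (a 0F) (c 0F)) ×
                    (∀ i j → block i ≢ block j → col (a i) (c j) ≡ col (a 0F) (c 2F))

    shiftedSameBlock-only : ∀ i j → col (a i) (c (blockShift 1F j)) ≡ col (a 0F) (c 2F) →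
                            block i ≡ block j
    shiftedSameBlock-only i j e =
      subst (λ k → block i ≡ block k) (blockShift-involutive 1F j)
            (≢⇒sameBlock-blockShift (blockShift 1F j)
              (λ i~j′ → case sameBlock-colour-stays e i~j′ of λ ()))

    -- Swapping the two blocks of the enumeration of Z turns the different-block
    -- entries into same-block entries.
    blockConstant-or-matching : HasMatching 𝒞 X Z ⊎ BlockConstant
    blockConstant-or-matching
      with sameBlockConstant-or-matching FX FZ a-enum c-enum
             (λ i j e → sameBlock-colour-stays (sym e) refl)
         | sameBlockConstant-or-matching FX FZ a-enum (Enumerates-blockShift 1F c-enum)
             shiftedSameBlock-only
    ... | inj₂ m    | _            = inj₁ m
    ... | inj₁ _    | inj₂ m       = inj₁ m
    ... | inj₁ same | inj₁ shifted = inj₂ (same , λ i j i≁j →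
          subst (λ k → col (a i) (c k) ≡ _) (blockShift-involutive 1F j)
                (shifted i (blockShift 1F j) (≢⇒sameBlock-blockShift j i≁j)))

    toType2K22 : BlockConstant → Type2K22 𝒞 X Z
    toType2K22 (same , different) = record
      { a = a ; b = c ; a-enum = a-enum ; b-enum = c-enum
      ; r = col (a 0F) (c 0F) ; s = col (a 0F) (c 2F)
      ; r-in = fiber-interspace FX FZ (enum-∈ a-enum 0F) (enum-∈ c-enum 0F)
      ; s-in = fiber-interspace FX FZ (enum-∈ a-enum 0F) (enum-∈ c-enum 2F)
      ; r≢s = λ e → case sameBlock-colour-stays e refl of λ ()
      ; sameBlock = same ; diffBlock = different
      }

    conclusion : HasMatching 𝒞 X Z ⊎
                 (Type2K22 𝒞 X Z × DirectlyConnected 𝒞 Z Y X × DirectlyConnected 𝒞 X Y Z)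
    conclusion with blockConstant-or-matching
    ... | inj₁ m        = inj₁ m
    ... | inj₂ constant =
          inj₂ (K , (K ᵀ , w₁ ᵀ , λ _ _ → ⇔-refl) , (K , w₂ ᵀ , λ _ _ → ⇔-refl))
      where K = toType2K22 constant

open Configuration using (realign; module Aligned)

lemma5p3 : {n : ℕ} (𝒞 : CoherentConfiguration n) (X Y Z : Subset n) →
    IsFiber 𝒞 X → IsFiber 𝒞 Y → IsFiber 𝒞 Z →
    X ≢ Y → Y ≢ Z → X ≢ Z →
    ∣ X ∣ ≡ 4 → ∣ Y ∣ ≡ 4 → ∣ Z ∣ ≡ 4 →
    DirectlyConnected 𝒞 X Z Y →
    HasMatching 𝒞 X Z ⊎
      (Type2K22 𝒞 X Z × DirectlyConnected 𝒞 Z Y X × DirectlyConnected 𝒞 X Y Z)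
lemma5p3 𝒞 X Y Z FX _ FZ _ _ _ _ _ _ (w₁ , w₂ , connected) =
  let (w₂′ , aligned) = realign 𝒞 w₁ w₂ connected
  in Aligned.conclusion 𝒞 FX FZ w₁ w₂′ aligned
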